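{- Let $n\ge 2$ be even, let $p_1,\dots,p_l$ be distinct primes each of which is a $\varphi$-divisor of $n$ of degree $k_i$ (with $p_i^{k_i}\ge 3$), let $2\le m\le\min(p_1^{k_1}-1,\dots,p_l^{k_l}-1)$, let $c=p_1^{n_1}\cdots p_l^{n_l}$ with natural $n_1,\dots,n_l$, and let $b$ be a nonnegative integer. Then $$P\Big(\sum_{i=1}^m x_i^n=bc^n\Big)=P\Big(\sum_{i=1}^m x_i^n=b\Big).$$
   Context: $P(f(x_1,\dots,x_m)=d)$ denotes the number of solutions $(x_1,\dots,x_m)$ in nonnegative integers. $\varphi$ is Euler's totient function. For an even natural number $n$, a prime $q$ is a $\varphi$-divisor of $n$ if there is a natural $k$ with $q^k\ge3$ and $\varphi(q^k)\mid n$; the largest such $k$ is its degree. -}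

module Defs where

open import Data.Nat using (ℕ; zero; suc; _+_; _*_; _^_; _≤_; _≟_)
open import Data.Nat.GCD using (gcd)
open import Data.Nat.Divisibility using (_∣_)
open import Data.Nat.Primality using (Prime)
open import Data.Fin using (Fin)
open import Data.Vec using (Vec; []; _∷_)
open import Data.List using (List; [_]; length; filter; map; upTo; concatMap)
open import Data.Product using (_×_)

φ : ℕ → ℕ
φ k = length (filter (λ i → gcd i k ≟ 1) (map suc (upTo k)))

IsPhiDivisorOfDegree : ℕ → ℕ → ℕ → Set
IsPhiDivisorOfDegree n q k =
  Prime q × (3 ≤ q ^ k) × (φ (q ^ k) ∣ n)
  × (∀ j → 3 ≤ q ^ j → φ (q ^ j) ∣ n → j ≤ k)

powSum : ∀ {m} → ℕ → Vec ℕ m → ℕ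
powSum n [] = 0
powSum n (x ∷ xs) = x ^ n + powSum n xs

tuples : (m d : ℕ) → List (Vec ℕ m)
tuples zero d = [ [] ]
tuples (suc m) d = concatMap (λ x → map (x ∷_) (tuples m d)) (upTo (suc d))

-- P(x_1^n + … + x_m^n = d): number of solutions in nonnegative integers.
-- For n ≥ 1 every solution has all x_i ≤ d, so enumerating {0,…,d}^m counts all solutions.
P : (m n d : ℕ) → ℕ
P m n d = length (filter (λ v → powSum n v ≟ d) (tuples m d))

prodFin : ∀ {l} → (Fin l → ℕ) → ℕ
prodFin {zero} f = 1
prodFin {suc l} f = f Fin.zero * prodFin (λ i → f (Fin.suc i))

-- Let q be a φ-divisor of n of degree k and Q = qᵏ > m. By Euler's theorem xⁿ ≡ 1 (mod Q) when
-- q ∤ x, while xⁿ ≡ 0 (mod Q) when q ∣ x, because k ≤ φ(Q) ≤ n. Hence if x₁ⁿ + ⋯ + x_mⁿ = d qⁿ,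
-- the number of xᵢ prime to q is ≡ 0 (mod Q) and smaller than Q, so it is 0: all xᵢ are multiples
-- of q, and division by q maps the solutions for d qⁿ bijectively onto those for d. Applying this
-- once for every prime factor of c gives the theorem.
module Submission where

open import Defs
open import Data.Empty using (⊥-elim)
open import Data.Fin using (Fin)
open import Data.List using (List; []; _∷_; _++_; map; filter; upTo; length; concatMap; cartesianProductWith)
open import Data.List.Membership.Propositional using (_∈_)
open import Data.List.Membership.Propositional.Properties
  using (∈-filter⁺; ∈-filter⁻; ∈-map⁺; ∈-map⁻; ∈-upTo⁺; ∈-upTo⁻; ∈-cartesianProductWith⁺)
import Data.List.Membership.DecPropositional as DecMembership
open import Data.List.Membership.Propositional.Properties.WithK using (unique∧set⇒bag)
open import Data.List.Properties using (length-map; length-upTo; length-filter)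
open import Data.List.Relation.Binary.BagAndSetEquality using (∼bag⇒↭)
open import Data.List.Relation.Binary.Permutation.Propositional using (_↭_)
open import Data.List.Relation.Binary.Permutation.Propositional.Properties using (↭-length)
open import Data.List.Relation.Binary.Subset.Propositional using (_⊆_)
open import Data.List.Relation.Unary.All as All using (All; []; _∷_)
open import Data.List.Relation.Unary.All.Properties using () renaming (map⁺ to All-map⁺)
open import Data.List.Relation.Unary.Any using (here; there)
open import Data.List.Relation.Unary.Unique.Propositional using (Unique; []; _∷_)
open import Data.List.Relation.Unary.Unique.Propositional.Properties
  using (map⁺; filter⁺; upTo⁺; cartesianProductWith⁺)
open import Data.Nat using (ℕ; zero; suc; z<s; _+_; _∸_; _*_; _^_; _≤_; _<_; _≟_; z≤n; s≤s; NonZero; NonTrivial; >-nonZero; n>1⇒nonTrivial; nonTrivial⇒n>1)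
open import Data.Nat.Properties
open import Data.Nat.DivMod
  using (_%_; _/_; %-distribˡ-+; %-distribˡ-*; m%n%n≡m%n; m<n⇒m%n≡m; m%n<n; [m+kn]%n≡m%n; m*[n/m]≡n)
open import Data.Nat.Divisibility
open import Data.Nat.GCD using (gcd; module Bézout)
open import Data.Nat.Coprimality as Coprime
  using (Coprime; coprime⇒gcd≡1; gcd≡1⇒coprime; coprime-Bézout; coprime-divisor; 1-coprimeTo; ¬0-coprimeTo-2+)
open import Data.Nat.Primality using (Prime; prime⇒irreducible; prime⇒nonZero; prime⇒nonTrivial)
open import Data.Nat.ListAction using (product)
open import Data.Nat.ListAction.Properties using (product-↭)
open import Data.Nat.Tactic.RingSolver using (solve-∀)
open import Algebra.Properties.CommutativeSemigroup *-commutativeSemigroup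
  using (interchange; xy∙z≈xz∙y; x∙yz≈xz∙y)
open import Data.Product using (∃; _×_; _,_; proj₁; proj₂)
open import Data.Sum using (inj₁; inj₂)
open import Data.Vec as Vec using (Vec; []; _∷_; count)
open import Data.Vec.Properties using (∷-injective; count≤n)
open import Data.Vec.Relation.Unary.All as VecAll using ([]; _∷_)
open import Function.Base using (_∘_)
open import Function.Bundles using (mk⇔)
open import Function.Definitions using (Injective)
open import Relation.Nullary using (¬_; yes; no; ¬?)
open import Relation.Unary using (Decidable)
open import Relation.Binary.Definitions using (DecidableEquality; tri<; tri≈; tri>)
open import Relation.Binary.PropositionalEquality

private
  variable
    a b c u v x z : ℕ

^-distribʳ-* : ∀ a b n → (a * b) ^ n ≡ a ^ n * b ^ n
^-distribʳ-* a b zero    = refl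
^-distribʳ-* a b (suc n) = trans (cong (a * b *_) (^-distribʳ-* a b n)) (interchange a b (a ^ n) (b ^ n))

m≤m^n : ∀ m n .{{_ : NonZero n}} → m ≤ m ^ n
m≤m^n zero    (suc n) = z≤n
m≤m^n (suc m) (suc n) = m≤m*n (suc m) (suc m ^ n) {{m^n≢0 (suc m) n}}

module _ {m : ℕ} (1<m : 1 < m) where

  1<m^[1+n] : ∀ n → 1 < m ^ suc n
  1<m^[1+n] n = <-≤-trans 1<m (m≤m^n m (suc n))

  ^-cancelˡ-≡ : m ^ a ≡ m ^ b → a ≡ b
  ^-cancelˡ-≡ {a} {b} mᵃ≡mᵇ with <-cmp a b
  ... | tri< a<b _ _ = ⊥-elim (<⇒≢ (^-monoʳ-< m 1<m a<b) mᵃ≡mᵇ)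
  ... | tri≈ _ a≡b _ = a≡b
  ... | tri> _ _ b<a = ⊥-elim (>⇒≢ (^-monoʳ-< m 1<m b<a) mᵃ≡mᵇ)

coprime-*ʳ : Coprime a b → Coprime a c → Coprime a (b * c)
coprime-*ʳ a⊥b a⊥c (d∣a , d∣bc) = a⊥c (d∣a , coprime-divisor (λ (i∣d , i∣b) → a⊥b (∣-trans i∣d d∣a , i∣b)) d∣bc)

coprime-*ˡ : Coprime a c → Coprime b c → Coprime (a * b) c
coprime-*ˡ a⊥c b⊥c = Coprime.sym (coprime-*ʳ (Coprime.sym a⊥c) (Coprime.sym b⊥c))

coprime-product : ∀ {Q rs} → All (λ r → Coprime r Q) rs → Coprime (product rs) Q
coprime-product []           = 1-coprimeTo _
coprime-product (r⊥Q ∷ rs⊥Q) = coprime-*ˡ r⊥Q (coprime-product rs⊥Q)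

prime∤⇒coprime : ∀ {q} → Prime q → ¬ q ∣ a → Coprime a q
prime∤⇒coprime q-prime q∤a (d∣a , d∣q) with prime⇒irreducible q-prime d∣q
... | inj₁ d≡1 = d≡1
... | inj₂ refl = ⊥-elim (q∤a d∣a)

prime∤⇒coprime-^ : ∀ {q} → Prime q → ¬ q ∣ a → ∀ k → Coprime a (q ^ k)
prime∤⇒coprime-^ q-prime q∤a zero    = Coprime.sym (1-coprimeTo _)
prime∤⇒coprime-^ q-prime q∤a (suc k) = coprime-*ʳ (prime∤⇒coprime q-prime q∤a) (prime∤⇒coprime-^ q-prime q∤a k)

module _ {A : Set} where

  unique-⊆-⊇⇒↭ : {xs ys : List A} → Unique xs → Unique ys → xs ⊆ ys → ys ⊆ xs → xs ↭ ys
  unique-⊆-⊇⇒↭ xs! ys! xs⊆ys ys⊆xs = ∼bag⇒↭ (unique∧set⇒bag xs! ys! (mk⇔ xs⊆ys ys⊆xs))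

  unique-⊆⇒length≤ : {xs ys : List A} → DecidableEquality A → Unique xs → Unique ys → xs ⊆ ys → length xs ≤ length ys
  unique-⊆⇒length≤ {xs} {ys} _≟ₐ_ xs! ys! xs⊆ys = begin
    length xs                   ≡⟨ ↭-length (unique-⊆-⊇⇒↭ xs! (filter⁺ (_∈? xs) ys!) xs⊆ys′ (proj₂ ∘ ∈-filter⁻ (_∈? xs) {xs = ys})) ⟩
    length (filter (_∈? xs) ys) ≤⟨ length-filter (_∈? xs) ys ⟩
    length ys                   ∎
    where
    open ≤-Reasoning
    open DecMembership _≟ₐ_ using (_∈?_)
    xs⊆ys′ : xs ⊆ filter (_∈? xs) ys
    xs⊆ys′ x∈xs = ∈-filter⁺ (_∈? xs) (xs⊆ys x∈xs) x∈xs

  map⁺-injectiveOn : ∀ {B : Set} {f : A → B} {xs} → (∀ {x y} → x ∈ xs → y ∈ xs → f x ≡ f y → x ≡ y) → Unique xs → Unique (map f xs)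
  map⁺-injectiveOn {xs = []}     f-inj []           = []
  map⁺-injectiveOn {xs = x ∷ xs} f-inj (x∉xs ∷ xs!) =
    All-map⁺ (All.tabulate λ y∈xs fx≡fy → All.lookup x∉xs y∈xs (f-inj (here refl) (there y∈xs) fx≡fy))
    ∷ map⁺-injectiveOn (λ x∈ y∈ → f-inj (there x∈) (there y∈)) xs!

module _ {Q : ℕ} .{{_ : NonZero Q}} where

  %-cong-*ʳ : ∀ c → a % Q ≡ b % Q → a * c % Q ≡ b * c % Q
  %-cong-*ʳ {a} {b} c a≡b = begin
    a * c % Q             ≡⟨ %-distribˡ-* a c Q ⟩
    a % Q * (c % Q) % Q   ≡⟨ cong (λ t → t * (c % Q) % Q) a≡b ⟩
    b % Q * (c % Q) % Q   ≡⟨ %-distribˡ-* b c Q ⟨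
    b * c % Q             ∎
    where open ≡-Reasoning

  %-cong-*ˡ : ∀ a → b % Q ≡ c % Q → a * b % Q ≡ a * c % Q
  %-cong-*ˡ {b} {c} a b≡c = begin
    a * b % Q ≡⟨ cong (_% Q) (*-comm a b) ⟩
    b * a % Q ≡⟨ %-cong-*ʳ a b≡c ⟩
    c * a % Q ≡⟨ cong (_% Q) (*-comm c a) ⟩
    a * c % Q ∎
    where open ≡-Reasoning

  %≡1⇒^%≡1 : ∀ k → a % Q ≡ 1 % Q → a ^ k % Q ≡ 1 % Q
  %≡1⇒^%≡1 zero    a≡1 = refl
  %≡1⇒^%≡1 {a} (suc k) a≡1 = begin
    a * a ^ k % Q ≡⟨ %-cong-*ʳ (a ^ k) a≡1 ⟩
    1 * a ^ k % Q ≡⟨ cong (_% Q) (*-identityˡ (a ^ k)) ⟩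
    a ^ k % Q     ≡⟨ %≡1⇒^%≡1 k a≡1 ⟩
    1 % Q         ∎
    where open ≡-Reasoning

  *%≡1⇒coprime : a * b % Q ≡ 1 % Q → Coprime b Q
  *%≡1⇒coprime {a} ab≡1 (d∣b , d∣Q) =
    ∣1⇒≡1 (∣n∣m%n⇒∣m d∣Q (subst (_ ∣_) ab≡1 (%-presˡ-∣ (∣n⇒∣m*n a d∣b) d∣Q)))

  coprime-% : Coprime a Q → Coprime (a % Q) Q
  coprime-% a⊥Q (d∣a%Q , d∣Q) = a⊥Q (∣n∣m%n⇒∣m d∣Q d∣a%Q , d∣Q)

  product-map-*-% : ∀ a rs → product (map (λ r → a * r % Q) rs) % Q ≡ a ^ length rs * product rs % Q
  product-map-*-% a []       = refl
  product-map-*-% a (r ∷ rs) = begin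
    (a * r % Q) * product (map (λ r → a * r % Q) rs) % Q ≡⟨ %-cong-*ʳ _ (m%n%n≡m%n (a * r) Q) ⟩
    (a * r) * product (map (λ r → a * r % Q) rs) % Q     ≡⟨ %-cong-*ˡ (a * r) (product-map-*-% a rs) ⟩
    (a * r) * (a ^ length rs * product rs) % Q           ≡⟨ cong (_% Q) (interchange a r (a ^ length rs) (product rs)) ⟩
    (a * a ^ length rs) * (r * product rs) % Q           ∎
    where open ≡-Reasoning

-- Bézout gives x a ≡ ± 1 (mod Q); in the "−1" case, x (Q − 1) is the inverse.
%-inverse : ∀ Q .{{_ : NonZero Q}} → Coprime a Q → ∃ λ y → a * y % Q ≡ 1 % Q
%-inverse {a} (suc Q₀) a⊥Q with coprime-Bézout a⊥Q
... | Bézout.+- x y 1+yQ≡xa = x , (begin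
  a * x % Q             ≡⟨ cong (_% Q) (trans (*-comm a x) (sym 1+yQ≡xa)) ⟩
  (1 + y * Q) % Q       ≡⟨ [m+kn]%n≡m%n 1 y Q ⟩
  1 % Q                 ∎)
  where open ≡-Reasoning; Q = suc Q₀
... | Bézout.-+ x y 1+xa≡yQ = x * Q₀ , (begin
  a * (x * Q₀) % Q             ≡⟨ [m+kn]%n≡m%n (a * (x * Q₀)) y Q ⟨
  (a * (x * Q₀) + y * Q) % Q   ≡⟨ cong (λ t → (a * (x * Q₀) + t) % Q) (sym 1+xa≡yQ) ⟩
  (a * (x * Q₀) + (1 + x * a)) % Q ≡⟨ cong (_% Q) (rearrange a x Q₀) ⟩
  (1 + x * a * Q) % Q          ≡⟨ [m+kn]%n≡m%n 1 (x * a) Q ⟩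
  1 % Q                        ∎)
  where
  open ≡-Reasoning
  Q = suc Q₀
  rearrange : ∀ a x Q₀ → a * (x * Q₀) + (1 + x * a) ≡ 1 + x * a * suc Q₀
  rearrange = solve-∀

%-cancelˡ-* : ∀ {Q} .{{_ : NonZero Q}} → Coprime a Q → a * u % Q ≡ a * v % Q → u % Q ≡ v % Q
%-cancelˡ-* {a} {u} {v} {Q} a⊥Q au≡av with y , ay≡1 ← %-inverse Q a⊥Q = begin
  u % Q           ≡⟨ cong (_% Q) (*-identityˡ u) ⟨
  1 * u % Q       ≡⟨ %-cong-*ʳ u ay≡1 ⟨
  a * y * u % Q   ≡⟨ cong (_% Q) (xy∙z≈xz∙y a y u) ⟩
  a * u * y % Q   ≡⟨ %-cong-*ʳ y au≡av ⟩
  a * v * y % Q   ≡⟨ cong (_% Q) (xy∙z≈xz∙y a v y) ⟩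
  a * y * v % Q   ≡⟨ %-cong-*ʳ v ay≡1 ⟩
  1 * v % Q       ≡⟨ cong (_% Q) (*-identityˡ v) ⟩
  v % Q           ∎
  where open ≡-Reasoning

-- Euler's theorem

module Totatives (Q : ℕ) (1<Q : 1 < Q) where

  instance
    Q-nonZero : NonZero Q
    Q-nonZero = >-nonZero (<-trans z<s 1<Q)

    Q-nonTrivial : NonTrivial Q
    Q-nonTrivial = n>1⇒nonTrivial 1<Q

  1%Q≡1 : 1 % Q ≡ 1
  1%Q≡1 = m<n⇒m%n≡m 1<Q

  totatives : List ℕ
  totatives = filter (λ i → gcd i Q ≟ 1) (map suc (upTo Q))

  totatives-unique : Unique totatives
  totatives-unique = filter⁺ (λ i → gcd i Q ≟ 1) (map⁺ suc-injective (upTo⁺ Q))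

  ∈-totatives⁺ : Coprime z Q → z < Q → z ∈ totatives
  ∈-totatives⁺ {zero}  0⊥Q _         = ⊥-elim (¬0-coprimeTo-2+ 0⊥Q)
  ∈-totatives⁺ {suc z} z⊥Q (s≤s z<Q) =
    ∈-filter⁺ (λ i → gcd i Q ≟ 1) (∈-map⁺ suc (∈-upTo⁺ (m≤n⇒m≤1+n z<Q))) (coprime⇒gcd≡1 z⊥Q)

  ∈-totatives⁻ : z ∈ totatives → Coprime z Q × z < Q
  ∈-totatives⁻ z∈ with z∈map , gcd≡1 ← ∈-filter⁻ (λ i → gcd i Q ≟ 1) {xs = map suc (upTo Q)} z∈
                   with i , i∈ , refl ← ∈-map⁻ suc z∈map
    = z⊥Q , ≤∧≢⇒< (∈-upTo⁻ i∈) λ { refl → >⇒≢ 1<Q (z⊥Q (∣-refl , ∣-refl)) }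
    where
    z⊥Q : Coprime (suc i) Q
    z⊥Q = gcd≡1⇒coprime gcd≡1

  %-∈-totatives : Coprime z Q → z % Q ∈ totatives
  %-∈-totatives {z} z⊥Q = ∈-totatives⁺ (coprime-% z⊥Q) (m%n<n z Q)

  totative-% : z ∈ totatives → z % Q ≡ z
  totative-% = m<n⇒m%n≡m ∘ proj₂ ∘ ∈-totatives⁻

  module _ (x⊥Q : Coprime x Q) where

    private
      x*_%Q : ℕ → ℕ
      x*_%Q r = x * r % Q

    *-permutes-totatives : map x*_%Q totatives ↭ totatives
    *-permutes-totatives = unique-⊆-⊇⇒↭ image-unique totatives-unique image⊆ ⊆image
      where
      image-unique : Unique (map x*_%Q totatives)
      image-unique = map⁺-injectiveOn
        (λ r∈ s∈ xr≡xs → trans (sym (totative-% r∈)) (trans (%-cancelˡ-* x⊥Q xr≡xs) (totative-% s∈)))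
        totatives-unique
      image⊆ : map x*_%Q totatives ⊆ totatives
      image⊆ z∈ with r , r∈ , refl ← ∈-map⁻ x*_%Q z∈ = %-∈-totatives (coprime-*ˡ x⊥Q (proj₁ (∈-totatives⁻ r∈)))
      ⊆image : totatives ⊆ map x*_%Q totatives
      ⊆image {z} z∈ with y , xy≡1 ← %-inverse Q x⊥Q =
        subst (_∈ map x*_%Q totatives) x*yz≡z (∈-map⁺ x*_%Q (%-∈-totatives yz⊥Q))
        where
        yz⊥Q : Coprime (y * z) Q
        yz⊥Q = coprime-*ˡ (*%≡1⇒coprime {a = x} {b = y} xy≡1) (proj₁ (∈-totatives⁻ z∈))
        x*yz≡z : x * (y * z % Q) % Q ≡ z
        x*yz≡z = begin
          x * (y * z % Q) % Q ≡⟨ %-cong-*ˡ x (m%n%n≡m%n (y * z) Q) ⟩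
          x * (y * z) % Q     ≡⟨ cong (_% Q) (*-assoc x y z) ⟨
          x * y * z % Q       ≡⟨ %-cong-*ʳ {Q = Q} z xy≡1 ⟩
          1 * z % Q           ≡⟨ cong (_% Q) (*-identityˡ z) ⟩
          z % Q               ≡⟨ totative-% z∈ ⟩
          z                   ∎
          where open ≡-Reasoning

  euler : Coprime x Q → x ^ φ Q % Q ≡ 1
  euler {x} x⊥Q = trans (%-cancelˡ-* (coprime-product (All.tabulate (proj₁ ∘ ∈-totatives⁻))) Π*xᵠ≡Π*1) 1%Q≡1
    where
    Π = product totatives
    Π*xᵠ≡Π*1 : Π * x ^ φ Q % Q ≡ Π * 1 % Q
    Π*xᵠ≡Π*1 = begin
      Π * x ^ φ Q % Q                              ≡⟨ cong (_% Q) (*-comm Π (x ^ φ Q)) ⟩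
      x ^ φ Q * Π % Q                              ≡⟨ product-map-*-% x totatives ⟨
      product (map (λ r → x * r % Q) totatives) % Q ≡⟨ cong (_% Q) (product-↭ (*-permutes-totatives x⊥Q)) ⟩
      Π % Q                                        ≡⟨ cong (_% Q) (*-identityʳ Π) ⟨
      Π * 1 % Q                                    ∎
      where open ≡-Reasoning

  length≤φ : ∀ {zs} → Unique zs → (∀ {z} → z ∈ zs → Coprime z Q × z < Q) → length zs ≤ φ Q
  length≤φ zs! zs-totatives =
    unique-⊆⇒length≤ _≟_ zs! totatives-unique (λ z∈ → ∈-totatives⁺ (proj₁ (zs-totatives z∈)) (proj₂ (zs-totatives z∈)))

module _ {q} (q-prime : Prime q) where

  private
    1<q : 1 < q
    1<q = nonTrivial⇒n>1 q {{prime⇒nonTrivial q-prime}}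

    instance
      q-nonZero : NonZero q
      q-nonZero = prime⇒nonZero q-prime

  -- 1 together with 1 + q^j for 0 < j ≤ k are k + 1 distinct totatives of q^(k+1).
  k≤φ[q^k] : ∀ k → k ≤ φ (q ^ k)
  k≤φ[q^k] zero    = z≤n
  k≤φ[q^k] (suc k) = subst (_≤ φ Q) length-witnesses (Totatives.length≤φ Q (1<m^[1+n] 1<q k) witnesses-unique witness-totative)
    where
    Q = q ^ suc k
    1+q^[1+_] : ℕ → ℕ
    1+q^[1+ j ] = suc (q ^ suc j)
    witnesses : List ℕ
    witnesses = 1 ∷ map 1+q^[1+_] (upTo k)

    length-witnesses : length witnesses ≡ suc k
    length-witnesses = cong suc (trans (length-map 1+q^[1+_] (upTo k)) (length-upTo k))

    witnesses-unique : Unique witnesses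
    witnesses-unique =
      All-map⁺ (All.tabulate λ {j} _ 1≡1+q^[1+j] → <⇒≢ (m^n>0 q (suc j)) (suc-injective 1≡1+q^[1+j]))
      ∷ map⁺ (λ eq → suc-injective (^-cancelˡ-≡ 1<q (suc-injective eq))) (upTo⁺ k)

    witness-totative : ∀ {z} → z ∈ witnesses → Coprime z Q × z < Q
    witness-totative (here refl) = 1-coprimeTo Q , 1<m^[1+n] 1<q k
    witness-totative (there z∈) with j , j∈ , refl ← ∈-map⁻ 1+q^[1+_] z∈ =
      prime∤⇒coprime-^ q-prime q∤ (suc k) , bound
      where
      r = q ^ suc j
      q∤ : ¬ q ∣ suc r
      q∤ q∣1+r = <⇒≢ 1<q (sym (∣1⇒≡1 (∣m+n∣m⇒∣n (subst (q ∣_) (+-comm 1 r) q∣1+r) (m∣m*n (q ^ j)))))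
      bound : suc r < Q
      bound = begin-strict
        suc r   <⟨ +-monoˡ-< r (1<m^[1+n] 1<q j) ⟩
        r + r   ≡⟨ cong (r +_) (+-identityʳ r) ⟨
        2 * r   ≤⟨ *-monoˡ-≤ r 1<q ⟩
        q * r   ≤⟨ ^-monoʳ-≤ q (s≤s (∈-upTo⁻ j∈)) ⟩
        Q       ∎
        where open ≤-Reasoning

-- Counting solutions

solutions : (m n d : ℕ) → List (Vec ℕ m)
solutions m n d = filter (λ v → powSum n v ≟ d) (tuples m d)

concatMap-map≡cartesianProductWith : ∀ {A B C : Set} (f : A → B → C) xs ys →
  concatMap (λ x → map (f x) ys) xs ≡ cartesianProductWith f xs ys
concatMap-map≡cartesianProductWith f []       ys = refl
concatMap-map≡cartesianProductWith f (x ∷ xs) ys = cong (map (f x) ys ++_) (concatMap-map≡cartesianProductWith f xs ys)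

tuples-unique : ∀ m d → Unique (tuples m d)
tuples-unique zero    d = [] ∷ []
tuples-unique (suc m) d = subst Unique (sym (concatMap-map≡cartesianProductWith _∷_ (upTo (suc d)) (tuples m d)))
  (cartesianProductWith⁺ _∷_ ∷-injective (upTo⁺ (suc d)) (tuples-unique m d))

∈-tuples⁺ : ∀ {m d} {v : Vec ℕ m} → VecAll.All (_≤ d) v → v ∈ tuples m d
∈-tuples⁺                       []            = here refl
∈-tuples⁺ {suc m} {d} {x ∷ v} (x≤d ∷ v≤d) = subst (x ∷ v ∈_) (sym (concatMap-map≡cartesianProductWith _∷_ (upTo (suc d)) (tuples m d)))
  (∈-cartesianProductWith⁺ _∷_ (∈-upTo⁺ (s≤s x≤d)) (∈-tuples⁺ v≤d))

entries≤powSum : ∀ n .{{_ : NonZero n}} {m} (v : Vec ℕ m) → VecAll.All (_≤ powSum n v) v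
entries≤powSum n []      = []
entries≤powSum n (x ∷ v) =
  ≤-trans (m≤m^n x n) (m≤m+n (x ^ n) (powSum n v))
  ∷ VecAll.map (λ y≤ → ≤-trans y≤ (m≤n+m (powSum n v) (x ^ n))) (entries≤powSum n v)

module _ {m n d : ℕ} where

  solutions-unique : Unique (solutions m n d)
  solutions-unique = filter⁺ (λ v → powSum n v ≟ d) (tuples-unique m d)

  ∈-solutions⁺ : .{{_ : NonZero n}} {v : Vec ℕ m} → powSum n v ≡ d → v ∈ solutions m n d
  ∈-solutions⁺ {v} refl = ∈-filter⁺ (λ v → powSum n v ≟ d) (∈-tuples⁺ (entries≤powSum n v)) refl

  ∈-solutions⁻ : {v : Vec ℕ m} → v ∈ solutions m n d → powSum n v ≡ d
  ∈-solutions⁻ = proj₂ ∘ ∈-filter⁻ (λ v → powSum n v ≟ d) {xs = tuples m d}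

module _ {q : ℕ} .{{_ : NonZero q}} where

  scale : ∀ {m} → Vec ℕ m → Vec ℕ m
  scale = Vec.map (q *_)

  scale-injective : ∀ {m} → Injective _≡_ _≡_ (scale {m})
  scale-injective {x = []}    {[]}    refl = refl
  scale-injective {x = x ∷ v} {y ∷ w} qx∷qv≡qy∷qw with qx≡qy , qv≡qw ← ∷-injective qx∷qv≡qy∷qw =
    cong₂ _∷_ (*-cancelˡ-≡ x y q qx≡qy) (scale-injective qv≡qw)

  scale-/ : ∀ {m} {v : Vec ℕ m} → VecAll.All (q ∣_) v → scale (Vec.map (_/ q) v) ≡ v
  scale-/ []            = refl
  scale-/ (q∣x ∷ q∣v) = cong₂ _∷_ (m*[n/m]≡n q∣x) (scale-/ q∣v)

  powSum-scale : ∀ n {m} (v : Vec ℕ m) → powSum n (scale v) ≡ q ^ n * powSum n v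
  powSum-scale n []      = sym (*-zeroʳ (q ^ n))
  powSum-scale n (x ∷ v) = trans (cong₂ _+_ (^-distribʳ-* q x n) (powSum-scale n v)) (sym (*-distribˡ-+ (q ^ n) (x ^ n) (powSum n v)))

  P-*-^≡P : ∀ {m n d} .{{_ : NonZero n}} → (∀ v → powSum n v ≡ d * q ^ n → VecAll.All (q ∣_) v) → P m n (d * q ^ n) ≡ P m n d
  P-*-^≡P {m} {n} {d} all-multiples = begin
    P m n (d * q ^ n)                    ≡⟨ ↭-length scale-solutions↭ ⟨
    length (map scale (solutions m n d)) ≡⟨ length-map scale (solutions m n d) ⟩
    P m n d                              ∎
    where
    open ≡-Reasoning
    qⁿ≢0 : NonZero (q ^ n)
    qⁿ≢0 = m^n≢0 q n

    powSum-scale≡ : ∀ {w : Vec ℕ m} → powSum n w ≡ d → powSum n (scale w) ≡ d * q ^ n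
    powSum-scale≡ {w} w-sol = trans (powSum-scale n w) (trans (*-comm (q ^ n) (powSum n w)) (cong (_* q ^ n) w-sol))

    ⊆solutions : map scale (solutions m n d) ⊆ solutions m n (d * q ^ n)
    ⊆solutions v∈ with w , w∈ , refl ← ∈-map⁻ scale v∈ = ∈-solutions⁺ (powSum-scale≡ {w} (∈-solutions⁻ w∈))

    ⊇solutions : solutions m n (d * q ^ n) ⊆ map scale (solutions m n d)
    ⊇solutions {v} v∈ = subst (_∈ map scale (solutions m n d)) (scale-/ q∣v) (∈-map⁺ scale (∈-solutions⁺ powSum-v/q))
      where
      q∣v = all-multiples v (∈-solutions⁻ v∈)
      powSum-v/q : powSum n (Vec.map (_/ q) v) ≡ d
      powSum-v/q = *-cancelˡ-≡ _ d (q ^ n) {{qⁿ≢0}} (begin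
        q ^ n * powSum n (Vec.map (_/ q) v) ≡⟨ powSum-scale n (Vec.map (_/ q) v) ⟨
        powSum n (scale (Vec.map (_/ q) v)) ≡⟨ cong (powSum n) (scale-/ q∣v) ⟩
        powSum n v                          ≡⟨ ∈-solutions⁻ v∈ ⟩
        d * q ^ n                           ≡⟨ *-comm d (q ^ n) ⟩
        q ^ n * d                           ∎)

    scale-solutions↭ : map scale (solutions m n d) ↭ solutions m n (d * q ^ n)
    scale-solutions↭ = unique-⊆-⊇⇒↭ (map⁺ scale-injective solutions-unique) solutions-unique ⊆solutions ⊇solutions

-- φ-divisors

count¬≡0⇒All : ∀ {A : Set} {P : A → Set} (P? : Decidable P) {m} (v : Vec A m) → count (¬? ∘ P?) v ≡ 0 → VecAll.All P v
count¬≡0⇒All P? []      _       = []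
count¬≡0⇒All P? (x ∷ v) count≡0 with P? x
... | yes px = px ∷ count¬≡0⇒All P? v count≡0

module _ {n q k : ℕ} .{{_ : NonZero n}} (q-prime : Prime q) (1<q^k : 1 < q ^ k) (φ∣n : φ (q ^ k) ∣ n) where

  private
    Q = q ^ k
    open Totatives Q 1<q^k using (Q-nonZero; 1%Q≡1; euler)

  nonMultiples : ∀ {m} → Vec ℕ m → ℕ
  nonMultiples = count (λ x → ¬? (q ∣? x))

  k≤n : k ≤ n
  k≤n = ≤-trans (k≤φ[q^k] q-prime k) (∣⇒≤ φ∣n)

  q^k∣q^n : Q ∣ q ^ n
  q^k∣q^n = divides (q ^ (n ∸ k)) (trans (cong (q ^_) (sym (m+[n∸m]≡n k≤n))) (trans (^-distribˡ-+-* q k (n ∸ k)) (*-comm Q _)))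

  ^n%q^k≡1 : ¬ q ∣ x → x ^ n % Q ≡ 1
  ^n%q^k≡1 {x} q∤x = begin
    x ^ n % Q             ≡⟨ cong (λ e → x ^ e % Q) (trans (m∣n⇒n≡quotient*m φ∣n) (*-comm t (φ Q))) ⟩
    x ^ (φ Q * t) % Q     ≡⟨ cong (_% Q) (^-*-assoc x (φ Q) t) ⟨
    (x ^ φ Q) ^ t % Q     ≡⟨ %≡1⇒^%≡1 {Q = Q} t (trans (euler (prime∤⇒coprime-^ q-prime q∤x k)) (sym 1%Q≡1)) ⟩
    1 % Q                 ≡⟨ 1%Q≡1 ⟩
    1                     ∎
    where
    open ≡-Reasoning
    t = quotient φ∣n

  ^n%q^k≡0 : q ∣ x → x ^ n % Q ≡ 0
  ^n%q^k≡0 (divides y refl) = n∣m⇒m%n≡0 _ Q (subst (Q ∣_) (sym (^-distribʳ-* y q n)) (∣n⇒∣m*n (y ^ n) q^k∣q^n))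

  powSum%q^k : ∀ {m} (v : Vec ℕ m) → powSum n v % Q ≡ nonMultiples v % Q
  powSum%q^k []      = refl
  powSum%q^k (x ∷ v) with q ∣? x
  ... | yes q∣x = begin
    (x ^ n + powSum n v) % Q                 ≡⟨ %-distribˡ-+ (x ^ n) (powSum n v) Q ⟩
    (x ^ n % Q + powSum n v % Q) % Q         ≡⟨ cong₂ (λ a b → (a + b) % Q) (^n%q^k≡0 q∣x) (powSum%q^k v) ⟩
    nonMultiples v % Q % Q                   ≡⟨ m%n%n≡m%n (nonMultiples v) Q ⟩
    nonMultiples v % Q                       ∎
    where open ≡-Reasoning
  ... | no q∤x = begin
    (x ^ n + powSum n v) % Q                 ≡⟨ %-distribˡ-+ (x ^ n) (powSum n v) Q ⟩
    (x ^ n % Q + powSum n v % Q) % Q         ≡⟨ cong₂ (λ a b → (a + b) % Q) (trans (^n%q^k≡1 q∤x) (sym 1%Q≡1)) (powSum%q^k v) ⟩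
    (1 % Q + nonMultiples v % Q) % Q         ≡⟨ %-distribˡ-+ 1 (nonMultiples v) Q ⟨
    suc (nonMultiples v) % Q                 ∎
    where open ≡-Reasoning

  powSum≡*q^n⇒multiples : ∀ {m d} → m < Q → (v : Vec ℕ m) → powSum n v ≡ d * q ^ n → VecAll.All (q ∣_) v
  powSum≡*q^n⇒multiples {m} {d} m<Q v v-sol = count¬≡0⇒All (q ∣?_) v (begin
    nonMultiples v           ≡⟨ m<n⇒m%n≡m (≤-<-trans (count≤n _ v) m<Q) ⟨
    nonMultiples v % Q       ≡⟨ powSum%q^k v ⟨
    powSum n v % Q           ≡⟨ cong (_% Q) v-sol ⟩
    d * q ^ n % Q            ≡⟨ n∣m⇒m%n≡0 _ Q (∣-trans q^k∣q^n (n∣m*n d)) ⟩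
    0                        ∎)
    where open ≡-Reasoning

record ScaleInvariant (m n c : ℕ) : Set where
  constructor scaleInvariant
  field invariant : ∀ d → P m n (d * c ^ n) ≡ P m n d

open ScaleInvariant

module _ {m n : ℕ} where

  scaleInvariant-1 : ScaleInvariant m n 1
  scaleInvariant-1 = scaleInvariant λ d → cong (P m n) (trans (cong (d *_) (^-zeroˡ n)) (*-identityʳ d))

  scaleInvariant-* : ScaleInvariant m n a → ScaleInvariant m n b → ScaleInvariant m n (a * b)
  scaleInvariant-* {a} {b} a-inv b-inv = scaleInvariant λ d → begin
    P m n (d * (a * b) ^ n)       ≡⟨ cong (P m n) (trans (cong (d *_) (^-distribʳ-* a b n)) (x∙yz≈xz∙y d (a ^ n) (b ^ n))) ⟩
    P m n (d * b ^ n * a ^ n)     ≡⟨ invariant a-inv (d * b ^ n) ⟩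
    P m n (d * b ^ n)             ≡⟨ invariant b-inv d ⟩
    P m n d                       ∎
    where open ≡-Reasoning

  scaleInvariant-^ : ScaleInvariant m n a → ∀ e → ScaleInvariant m n (a ^ e)
  scaleInvariant-^ a-inv zero    = scaleInvariant-1
  scaleInvariant-^ a-inv (suc e) = scaleInvariant-* a-inv (scaleInvariant-^ a-inv e)

  scaleInvariant-prodFin : ∀ {l} {f : Fin l → ℕ} → (∀ i → ScaleInvariant m n (f i)) → ScaleInvariant m n (prodFin f)
  scaleInvariant-prodFin {zero}  f-inv = scaleInvariant-1
  scaleInvariant-prodFin {suc l} f-inv = scaleInvariant-* (f-inv Fin.zero) (scaleInvariant-prodFin (f-inv ∘ Fin.suc))

  scaleInvariant-φ-divisor : ∀ {q k} .{{_ : NonZero n}} → Prime q → 1 < q ^ k → φ (q ^ k) ∣ n → m < q ^ k → ScaleInvariant m n q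
  scaleInvariant-φ-divisor {k = k} q-prime 1<q^k φ∣n m<q^k =
    scaleInvariant λ d → P-*-^≡P {{prime⇒nonZero q-prime}} (powSum≡*q^n⇒multiples {k = k} q-prime 1<q^k φ∣n {d = d} m<q^k)

proposition3 : (n : ℕ) → 2 ≤ n → 2 ∣ n
    → (l : ℕ) (p k : Fin l → ℕ)
    → Injective _≡_ _≡_ p
    → (∀ i → IsPhiDivisorOfDegree n (p i) (k i))
    → (m : ℕ) → 2 ≤ m → (∀ i → m < p i ^ k i)
    → (e : Fin l → ℕ) (b : ℕ)
    → P m n (b * prodFin (λ i → p i ^ e i) ^ n) ≡ P m n b
proposition3 n 2≤n _ l p k _ φ-divisor m _ m<pᵏ e =
  invariant (scaleInvariant-prodFin λ i → scaleInvariant-^ (p-invariant i) (e i))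
  where
  instance
    n-nonZero : NonZero n
    n-nonZero = >-nonZero (<-trans z<s 2≤n)
  p-invariant : ∀ i → ScaleInvariant m n (p i)
  p-invariant i with p-prime , 3≤pᵏ , φ∣n , _ ← φ-divisor i =
    scaleInvariant-φ-divisor {k = k i} p-prime (<-trans (s≤s (s≤s z≤n)) 3≤pᵏ) φ∣n (m<pᵏ i)
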